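{- Let $h\geq 4$ be an integer. Let $A=\{0,a_2,\ldots,a_{h+1}\}$ be a set of nonnegative integers such that $0<a_2<\cdots<a_{h+1}$. Assume that $a_2\not\equiv 0\pmod 2$, $a_3=2a_2$ and $a_4=4a_2$. Then: (1) if $h=4$ and $A=a_2\ast\{0,1,2,4,6\}$, then $|4^{\wedge}_{\pm}A|=21$; (2) if $h=4$ and $A\neq a_2\ast\{0,1,2,4,6\}$, then $|4^{\wedge}_{\pm}A|\geq 23$; (3) if $h\geq 5$, then $|h^{\wedge}_{\pm}A|\geq \frac{3}{2}h(h-1)+3$ if $A=a_2\ast\{0,1,2j : j=1,\ldots,h-1\}$, and $|h^{\wedge}_{\pm}A|\geq h^2+h+2$ otherwise.
   Context: For a finite set $A=\{a_1,\ldots,a_k\}$ of integers and a positive integer $h$, the restricted $h$-fold signed sumset is $h^{\wedge}_{\pm}A=\left\{\sum_{i=1}^{k}\lambda_i a_i : \lambda_i\in\{ -1,0,1\} \text{ for all } i,\ \sum_{i=1}^{k}|\lambda_i| = h\right\}$. For an integer $c$ and a set $S$ of integers, $c\ast S=\{cs: s\in S\}$. -}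

module Defs where

open import Data.Nat using (ℕ; zero; suc; _<_; _≤_)
open import Data.Integer as ℤ using (ℤ; +_; -[1+_]; ∣_∣)
open import Data.List using (List; length)
open import Data.List.Membership.Propositional using (_∈_)
open import Data.List.Relation.Unary.Unique.Propositional using (Unique)
open import Data.Product using (Σ; ∃; _×_)
open import Data.Sum using (_⊎_)
open import Function.Bundles using (_⇔_)
open import Relation.Binary.PropositionalEquality using (_≡_)

sumℤ : ℕ → (ℕ → ℤ) → ℤ
sumℤ zero    f = + 0
sumℤ (suc n) f = f n ℤ.+ sumℤ n f

sumℕ : ℕ → (ℕ → ℕ) → ℕ
sumℕ zero    f = 0
sumℕ (suc n) f = f n Data.Nat.+ sumℕ n f

IsSign : ℤ → Set
IsSign x = (x ≡ -[1+ 0 ]) ⊎ (x ≡ + 0) ⊎ (x ≡ + 1)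

-- The set A = {a 0, …, a (k-1)} (given as a k-indexed family) and
-- membership of z in the restricted h-fold signed sumset h^∧_± A:
-- z = Σ_{i<k} λ_i a_i with λ_i ∈ {-1,0,1} and Σ |λ_i| = h.
InSignedSumset : (h k : ℕ) → (ℕ → ℕ) → ℤ → Set
InSignedSumset h k a z =
  Σ (ℕ → ℤ) λ lam →
    (∀ i → i < k → IsSign (lam i)) ×
    (sumℕ k (λ i → ∣ lam i ∣) ≡ h) ×
    (sumℤ k (λ i → lam i ℤ.* + (a i)) ≡ z)

HasSize : (ℤ → Set) → ℕ → Set
HasSize P n = Σ (List ℤ) λ xs → Unique xs × (∀ z → (z ∈ xs) ⇔ P z) × (length xs ≡ n)

SetEq : ℕ → (ℕ → ℕ) → (ℕ → Set) → Set
SetEq k a Q = ∀ x → (∃ λ i → i < k × a i ≡ x) ⇔ Q x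

module Submission where

-- Only signed sums with exactly one zero coefficient are used. With λ_p = 0 and all other
-- coefficients ±1 the sum is T_p − 2s, where T_p is the sum of A ∖ {a_p} and s is the sum of the
-- elements with coefficient −1, so distinct subset sums of A ∖ {a_p} give distinct elements of
-- h^∧_± A. As a₀ = 0 and a₁ is odd, T₀ − T₁ = a₁ is odd, so the families p = 0 and p = 1 are
-- disjoint. Their subset sums are counted by adjoining a₄, …, a_h one at a time: adjoining a new
-- largest element y to a list with total T adds the sums y + (T − b) for subset sums b < y (here
-- a_j, …, a₃ and a few small ones), all of which exceed T. After comparing a₄ and a₅ with multiples
-- of a₁ and counting the subset sums of the first elements of A/a₁, this gives h² + h + 2. When
-- A = a₁ * {0, 1, 2, 4, …, 2(h − 1)}, every multiple of a₁ (for p = 0), resp. of 2a₁ (for p = 1),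
-- up to the total is a subset sum. For h = 4 and a₄ ∈ {5a₁, 6a₁} the sumset is computed exactly,
-- by scaling to A/a₁ and enumerating all sign vectors.

open import Defs
open import Data.Nat as ℕ
  using (ℕ; zero; suc; _+_; _*_; _∸_; _≤_; _<_; _>_; z≤n; s≤s; _≤′_; ≤′-refl; ≤′-step; _≟_; _≤?_; NonZero)
import Data.Nat.Properties as ℕ
import Data.Nat.Tactic.RingSolver as ℕ
open import Data.Nat.ListAction using (sum)
open import Data.Nat.Divisibility using (_∣_; ∣m+n∣m⇒∣n; m∣m*n)
open import Data.Integer as ℤ using (ℤ; +_; -[1+_]; -1ℤ)
import Data.Integer.Properties as ℤ
open import Data.Integer.Tactic.RingSolver using (solve-∀)
open import Data.List using (List; []; _∷_; _++_; length; map; concatMap; filter; deduplicate; upTo; downFrom)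
open import Data.List.Properties using (length-++; length-map; length-upTo)
open import Data.List.Membership.Propositional using (_∈_; find; lose)
open import Data.List.Membership.Propositional.Properties
open import Data.List.Relation.Binary.Disjoint.Propositional using (Disjoint)
open import Data.List.Relation.Unary.Any using (here; there)
open import Data.List.Relation.Unary.All as All using (All; []; _∷_)
import Data.List.Relation.Unary.All.Properties as All
open import Data.List.Relation.Unary.AllPairs as AllPairs using ([]; _∷_)
open import Data.List.Relation.Unary.Linked as Linked using (Linked; []; [-]; _∷_)
open import Data.List.Relation.Unary.Linked.Properties using (Linked⇒AllPairs; Linked⇒All)
open import Data.List.Relation.Unary.Unique.Propositional using (Unique)
import Data.List.Relation.Unary.Unique.Propositional.Properties as Unique
open import Data.List.Relation.Unary.Unique.DecPropositional.Properties using (deduplicate-!)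
open import Data.Product using (Σ; ∃; _×_; _,_; proj₂)
open import Data.Sum using (_⊎_; inj₁; inj₂)
open import Function.Bundles using (_⇔_; mk⇔; Equivalence)
open import Algebra.Properties.CommutativeSemigroup ℕ.+-commutativeSemigroup using (x∙yz≈y∙xz)
open import Relation.Binary.PropositionalEquality
open import Relation.Binary.Definitions using (tri<; tri≈; tri>)
open import Relation.Nullary using (¬_; yes; no; contradiction)
open import Relation.Unary using (Decidable)

data SubsetSum : List ℕ → ℕ → Set where
  []   : SubsetSum [] 0
  skip : ∀ {x xs s} → SubsetSum xs s → SubsetSum (x ∷ xs) s
  pick : ∀ {x xs s} → SubsetSum xs s → SubsetSum (x ∷ xs) (x + s)

SubsetSum-0 : ∀ xs → SubsetSum xs 0
SubsetSum-0 []       = []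
SubsetSum-0 (x ∷ xs) = skip (SubsetSum-0 xs)

SubsetSum-single : ∀ {x xs} → SubsetSum (x ∷ xs) x
SubsetSum-single {x} {xs} = subst (SubsetSum (x ∷ xs)) (ℕ.+-identityʳ x) (pick (SubsetSum-0 xs))

SubsetSum⇒≤sum : ∀ {xs s} → SubsetSum xs s → s ≤ sum xs
SubsetSum⇒≤sum []           = z≤n
SubsetSum⇒≤sum {x ∷ _} (skip p) = ℕ.≤-trans (SubsetSum⇒≤sum p) (ℕ.m≤n+m _ x)
SubsetSum⇒≤sum (pick p)     = ℕ.+-monoʳ-≤ _ (SubsetSum⇒≤sum p)

SubsetSum-complement : ∀ {xs s} → SubsetSum xs s → SubsetSum xs (sum xs ∸ s)
SubsetSum-complement []                 = []
SubsetSum-complement {x ∷ xs} (skip p) =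
  subst (SubsetSum (x ∷ xs)) (sym (ℕ.+-∸-assoc x (SubsetSum⇒≤sum p))) (pick (SubsetSum-complement p))
SubsetSum-complement {x ∷ xs} (pick {s = s} p) =
  subst (SubsetSum (x ∷ xs)) (sym (ℕ.[m+n]∸[m+o]≡n∸o x (sum xs) s)) (skip (SubsetSum-complement p))

SubsetSum-scale : ∀ d {xs s} → SubsetSum xs s → SubsetSum (map (_* d) xs) (s * d)
SubsetSum-scale d []                 = []
SubsetSum-scale d (skip p)           = skip (SubsetSum-scale d p)
SubsetSum-scale d (pick {x} {s = s} p) =
  subst (SubsetSum _) (sym (ℕ.*-distribʳ-+ d x s)) (pick (SubsetSum-scale d p))

data Complete : List ℕ → Set where
  []  : Complete []
  _∷_ : ∀ {x xs} → x ≤ suc (sum xs) → Complete xs → Complete (x ∷ xs)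

Complete⇒SubsetSum : ∀ {xs k} → Complete xs → k ≤ sum xs → SubsetSum xs k
Complete⇒SubsetSum {[]}     []       z≤n = []
Complete⇒SubsetSum {x ∷ xs} {k} (x≤ ∷ c) k≤ with k ≤? sum xs
... | yes k≤sum = skip (Complete⇒SubsetSum c k≤sum)
... | no  k≰sum = subst (SubsetSum (x ∷ xs)) (ℕ.m+[n∸m]≡n x≤k) (pick (Complete⇒SubsetSum c k∸x≤sum))
  where
  x≤k : x ≤ k
  x≤k = ℕ.≤-trans x≤ (ℕ.≰⇒> k≰sum)
  k∸x≤sum : k ∸ x ≤ sum xs
  k∸x≤sum = subst (k ∸ x ≤_) (ℕ.m+n∸m≡n x (sum xs)) (ℕ.∸-monoˡ-≤ x k≤)

subsetSums : List ℕ → List ℕ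
subsetSums []       = 0 ∷ []
subsetSums (x ∷ xs) = subsetSums xs ++ map (_+_ x) (subsetSums xs)

subsetSums-sound : ∀ {xs s} → s ∈ subsetSums xs → SubsetSum xs s
subsetSums-sound {[]} (here refl) = []
subsetSums-sound {x ∷ xs} p with ∈-++⁻ (subsetSums xs) p
... | inj₁ q = skip (subsetSums-sound q)
... | inj₂ q with ∈-map⁻ (_+_ x) q
...   | s , s∈ , refl = pick (subsetSums-sound s∈)

DistinctSums : List ℕ → List ℕ → Set
DistinctSums xs L = Unique L × All (SubsetSum xs) L

extend : ∀ {y xs L C} → DistinctSums xs L → DistinctSums xs C →
         (∀ {b c} → b ∈ L → c ∈ C → y + c ≢ b) →
         DistinctSums (y ∷ xs) (L ++ map (_+_ y) C)
extend {y} {L = L} {C} (uL , sL) (uC , sC) fresh =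
  Unique.++⁺ uL (Unique.map⁺ (ℕ.+-cancelˡ-≡ y _ _) uC) disjoint ,
  All.++⁺ (All.map skip sL) (All.map⁺ (All.map pick sC))
  where
  disjoint : Disjoint L (map (_+_ y) C)
  disjoint (b∈ , v∈) with ∈-map⁻ (_+_ y) v∈
  ... | c , c∈ , refl = fresh b∈ c∈ refl

complement-unique : ∀ {T B} → All (_≤ T) B → Unique B → Unique (map (T ∸_) B)
complement-unique []          []          = []
complement-unique (b≤ ∷ bs≤) (b∉ ∷ uB) =
  All.map⁺ (All.zipWith (λ (b≢ , b'≤) e → b≢ (ℕ.∸-cancelˡ-≡ b≤ b'≤ e)) (b∉ , bs≤)) ∷ complement-unique bs≤ uB

DistinctSums-complement : ∀ {xs B} → DistinctSums xs B → DistinctSums xs (map (sum xs ∸_) B)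
DistinctSums-complement (uB , sB) =
  complement-unique (All.map SubsetSum⇒≤sum sB) uB , All.map⁺ (All.map SubsetSum-complement sB)

-- each new sum y + (sum xs ∸ b) exceeds sum xs, hence every old sum
grow : ∀ {y xs L B} → DistinctSums xs L → DistinctSums xs B → All (_< y) B →
       DistinctSums (y ∷ xs) (L ++ map (_+_ y) (map (sum xs ∸_) B))
grow {y} {xs} {L} {B} dL dB B<y = extend dL (DistinctSums-complement dB) fresh
  where
  fresh : ∀ {b c} → b ∈ L → c ∈ map (sum xs ∸_) B → y + c ≢ b
  fresh b∈ c∈ with ∈-map⁻ (sum xs ∸_) c∈
  ... | b' , b'∈ , refl = λ e → ℕ.<⇒≱ sum< (subst (_≤ sum xs) (sym e) (SubsetSum⇒≤sum (All.lookup (proj₂ dL) b∈)))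
    where
    sum< : sum xs < y + (sum xs ∸ b')
    sum< = subst (_< y + (sum xs ∸ b')) (ℕ.m+[n∸m]≡n (SubsetSum⇒≤sum (All.lookup (proj₂ dB) b'∈)))
                 (ℕ.+-monoˡ-< (sum xs ∸ b') (All.lookup B<y b'∈))

descending⇒unique : ∀ {xs} → Linked _>_ xs → Unique xs
descending⇒unique l = AllPairs.map ℕ.>⇒≢ (Linked⇒AllPairs (λ p q → ℕ.<-trans q p) l)

descending-below : ∀ {y xs} → Linked _>_ (y ∷ xs) → All (_< y) xs
descending-below [-]          = []
descending-below (y>x ∷ desc) = Linked⇒All (λ p q → ℕ.<-trans q p) y>x desc

DistinctSums-scale : ∀ d .{{_ : NonZero d}} {xs L} → DistinctSums xs L →
                     DistinctSums (map (_* d) xs) (map (_* d) L)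
DistinctSums-scale d (uL , sL) = Unique.map⁺ (ℕ.*-cancelʳ-≡ _ _ d) uL , All.map⁺ (All.map (SubsetSum-scale d) sL)

DistinctSums-filter : ∀ {P : ℕ → Set} (P? : Decidable P) {xs L} → DistinctSums xs L →
                      DistinctSums xs (filter P? L)
DistinctSums-filter P? (uL , sL) = Unique.filter⁺ P? uL , All.filter⁺ P? sL

sumsOf : List ℕ → List ℕ
sumsOf xs = deduplicate _≟_ (subsetSums xs)

DistinctSums-sumsOf : ∀ xs → DistinctSums xs (sumsOf xs)
DistinctSums-sumsOf xs =
  deduplicate-! _≟_ (subsetSums xs) , All.tabulate (λ p → subsetSums-sound (∈-deduplicate⁻ _≟_ (subsetSums xs) p))

SubsetSums≥ : List ℕ → ℕ → Set
SubsetSums≥ xs n = Σ (List ℕ) λ L → DistinctSums xs L × n ≤ length L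

grow≥ : ∀ {y xs n B} → SubsetSums≥ xs n → DistinctSums xs B → All (_< y) B → SubsetSums≥ (y ∷ xs) (n + length B)
grow≥ {y} {xs} {n} {B} (L , dL , n≤) dB B<y =
  _ , grow dL dB B<y , subst (n + length B ≤_) (sym lengths) (ℕ.+-monoˡ-≤ (length B) n≤)
  where
  lengths : length (L ++ map (_+_ y) (map (sum xs ∸_) B)) ≡ length L + length B
  lengths = trans (length-++ L)
    (cong (_+_ (length L)) (trans (length-map (_+_ y) (map (sum xs ∸_) B)) (length-map (sum xs ∸_) B)))

Complete⇒SubsetSums≥ : ∀ d .{{_ : NonZero d}} {cs} → Complete cs → SubsetSums≥ (map (_* d) cs) (suc (sum cs))
Complete⇒SubsetSums≥ d {cs} complete =
  map (_* d) (upTo (suc (sum cs))) ,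
  (Unique.map⁺ (ℕ.*-cancelʳ-≡ _ _ d) (Unique.upTo⁺ _) ,
   All.map⁺ (All.tabulate (λ k∈ → SubsetSum-scale d (Complete⇒SubsetSum complete (ℕ.≤-pred (∈-upTo⁻ k∈)))))) ,
  ℕ.≤-reflexive (sym (trans (length-map (_* d) (upTo (suc (sum cs)))) (length-upTo (suc (sum cs)))))

unique-⊆⇒length-≤ : ∀ {A : Set} {xs ys : List A} → Unique xs → (∀ {z} → z ∈ xs → z ∈ ys) → length xs ≤ length ys
unique-⊆⇒length-≤ {xs = []}     _          _  = z≤n
unique-⊆⇒length-≤ {xs = x ∷ xs} (x∉ ∷ u) xs⊆ with ∈-∃++ (xs⊆ (here refl))
... | ys₁ , ys₂ , refl = subst (suc (length xs) ≤_) (sym length-split) (s≤s (unique-⊆⇒length-≤ u xs⊆ys₁ys₂))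
  where
  length-split : length (ys₁ ++ x ∷ ys₂) ≡ suc (length (ys₁ ++ ys₂))
  length-split = trans (length-++ ys₁) (trans (ℕ.+-suc (length ys₁) (length ys₂)) (cong suc (sym (length-++ ys₁))))
  xs⊆ys₁ys₂ : ∀ {z} → z ∈ xs → z ∈ ys₁ ++ ys₂
  xs⊆ys₁ys₂ z∈ with ∈-++⁻ ys₁ (xs⊆ (there z∈))
  ... | inj₁ p          = ∈-++⁺ˡ p
  ... | inj₂ (here refl) = contradiction refl (All.lookup x∉ z∈)
  ... | inj₂ (there p)  = ∈-++⁺ʳ ys₁ p

HasSize-lower : ∀ {P n} → HasSize P n → ∀ {zs} → Unique zs → All P zs → length zs ≤ n
HasSize-lower (xs , _ , xs⇔P , refl) uzs Pzs =
  unique-⊆⇒length-≤ uzs (λ z∈ → Equivalence.from (xs⇔P _) (All.lookup Pzs z∈))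

HasSize-map : ∀ {P Q : ℤ → Set} {n} (f : ℤ → ℤ) → (∀ {w w'} → f w ≡ f w' → w ≡ w') →
              (∀ z → Q z ⇔ (∃ λ w → P w × f w ≡ z)) → HasSize P n → HasSize Q n
HasSize-map {P} {Q} f f-inj Q⇔ (xs , uxs , xs⇔P , refl) =
  map f xs , Unique.map⁺ f-inj uxs , (λ z → mk⇔ (to z) (from z)) , length-map f xs
  where
  to : ∀ z → z ∈ map f xs → Q z
  to z z∈ with ∈-map⁻ f z∈
  ... | w , w∈ , refl = Equivalence.from (Q⇔ z) (w , Equivalence.to (xs⇔P w) w∈ , refl)
  from : ∀ z → Q z → z ∈ map f xs
  from z Qz with Equivalence.to (Q⇔ z) Qz
  ... | w , Pw , refl = ∈-map⁺ f (Equivalence.from (xs⇔P w) Pw)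

sumℤ-cong : ∀ n {f g : ℕ → ℤ} → (∀ i → i < n → f i ≡ g i) → sumℤ n f ≡ sumℤ n g
sumℤ-cong zero    _   = refl
sumℤ-cong (suc n) f≗g = cong₂ ℤ._+_ (f≗g n ℕ.≤-refl) (sumℤ-cong n (λ i i<n → f≗g i (ℕ.m<n⇒m<1+n i<n)))

sumℕ-cong : ∀ n {f g : ℕ → ℕ} → (∀ i → i < n → f i ≡ g i) → sumℕ n f ≡ sumℕ n g
sumℕ-cong zero    _   = refl
sumℕ-cong (suc n) f≗g = cong₂ _+_ (f≗g n ℕ.≤-refl) (sumℕ-cong n (λ i i<n → f≗g i (ℕ.m<n⇒m<1+n i<n)))

weight : ℕ → (ℕ → ℤ) → ℕ
weight k λs = sumℕ k (λ i → ℤ.∣ λs i ∣)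

value : ℕ → (ℕ → ℕ) → (ℕ → ℤ) → ℤ
value k a λs = sumℤ k (λ i → λs i ℤ.* + a i)

weight-cong : ∀ k {f g} → (∀ i → i < k → f i ≡ g i) → weight k f ≡ weight k g
weight-cong k f≗g = sumℕ-cong k (λ i i<k → cong ℤ.∣_∣ (f≗g i i<k))

value-cong : ∀ k a {f g} → (∀ i → i < k → f i ≡ g i) → value k a f ≡ value k a g
value-cong k a f≗g = sumℤ-cong k (λ i i<k → cong (ℤ._* + a i) (f≗g i i<k))

update : (ℕ → ℤ) → ℕ → ℤ → ℕ → ℤ
update f k s i with i ≟ k
... | yes _ = s
... | no  _ = f i

update-≡ : ∀ f k s → update f k s k ≡ s
update-≡ f k s with k ≟ k
... | yes _   = refl
... | no k≢k = contradiction refl k≢k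

update-< : ∀ f k s {i} → i < k → update f k s i ≡ f i
update-< f k s {i} i<k with i ≟ k
... | yes refl = contradiction i<k (ℕ.n≮n i)
... | no  _    = refl

update-<suc : ∀ f k s (g : ℕ → ℤ) → (∀ i → i < k → f i ≡ g i) → g k ≡ s → ∀ i → i < suc k → update f k s i ≡ g i
update-<suc f k s g f≗g gk≡s i i<1+k with ℕ.m≤n⇒m<n∨m≡n (ℕ.≤-pred i<1+k)
... | inj₁ i<k  = trans (update-< f k s i<k) (f≗g i i<k)
... | inj₂ refl = trans (update-≡ f k s) (sym gk≡s)

signs : List ℤ
signs = -[1+ 0 ] ∷ + 0 ∷ + 1 ∷ []

IsSign⇒∈signs : ∀ {s} → IsSign s → s ∈ signs
IsSign⇒∈signs (inj₁ refl)        = here refl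
IsSign⇒∈signs (inj₂ (inj₁ refl)) = there (here refl)
IsSign⇒∈signs (inj₂ (inj₂ refl)) = there (there (here refl))

∈signs⇒IsSign : ∀ {s} → s ∈ signs → IsSign s
∈signs⇒IsSign (here refl)                 = inj₁ refl
∈signs⇒IsSign (there (here refl))         = inj₂ (inj₁ refl)
∈signs⇒IsSign (there (there (here refl))) = inj₂ (inj₂ refl)

signVectors : ℕ → List (ℕ → ℤ)
signVectors zero    = (λ _ → + 0) ∷ []
signVectors (suc k) = concatMap (λ f → map (update f k) signs) (signVectors k)

signVectors-sound : ∀ k {f} → f ∈ signVectors k → ∀ i → i < k → IsSign (f i)
signVectors-sound (suc k) f∈ i i<1+k with find (∈-concatMap⁻ (λ g → map (update g k) signs) {xs = signVectors k} f∈)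
... | g , g∈ , f∈g with ∈-map⁻ (update g k) f∈g
... | s , s∈ , refl with ℕ.m≤n⇒m<n∨m≡n (ℕ.≤-pred i<1+k)
... | inj₁ i<k  = subst IsSign (sym (update-< g k s i<k)) (signVectors-sound k g∈ i i<k)
... | inj₂ refl = subst IsSign (sym (update-≡ g k s)) (∈signs⇒IsSign s∈)

signVectors-complete : ∀ k {λs : ℕ → ℤ} → (∀ i → i < k → IsSign (λs i)) →
                       ∃ λ f → f ∈ signVectors k × (∀ i → i < k → f i ≡ λs i)
signVectors-complete zero    _     = _ , here refl , λ _ ()
signVectors-complete (suc k) {λs} sign with signVectors-complete k {λs} (λ i i<k → sign i (ℕ.m<n⇒m<1+n i<k))
... | g , g∈ , g≗λs =
  update g k (λs k) ,
  ∈-concatMap⁺ (λ g → map (update g k) signs) (lose g∈ (∈-map⁺ (update g k) (IsSign⇒∈signs (sign k ℕ.≤-refl)))) ,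
  update-<suc g k (λs k) λs g≗λs refl

signedSumset : ℕ → ℕ → (ℕ → ℕ) → List ℤ
signedSumset h k a = deduplicate ℤ._≟_ (map (value k a) (filter (λ f → weight k f ≟ h) (signVectors k)))

HasSize-signedSumset : ∀ h k a → HasSize (InSignedSumset h k a) (length (signedSumset h k a))
HasSize-signedSumset h k a = signedSumset h k a , deduplicate-! ℤ._≟_ _ , (λ z → mk⇔ (to z) (from z)) , refl
  where
  to : ∀ z → z ∈ signedSumset h k a → InSignedSumset h k a z
  to z z∈ with ∈-map⁻ (value k a) (∈-deduplicate⁻ ℤ._≟_ _ z∈)
  ... | f , f∈ , refl with ∈-filter⁻ (λ f → weight k f ≟ h) {xs = signVectors k} f∈
  ... | f∈′ , weight≡h = f , signVectors-sound k f∈′ , weight≡h , refl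
  from : ∀ z → InSignedSumset h k a z → z ∈ signedSumset h k a
  from z (λs , sign , weight≡h , value≡z) with signVectors-complete k sign
  ... | f , f∈ , f≗λs =
    subst (_∈ signedSumset h k a) (trans (value-cong k a f≗λs) value≡z)
      (∈-deduplicate⁺ ℤ._≟_ (∈-map⁺ (value k a)
        (∈-filter⁺ (λ f → weight k f ≟ h) f∈ (trans (weight-cong k f≗λs) weight≡h))))

value-scale : ∀ k {a c : ℕ → ℕ} d → (∀ i → i < k → a i ≡ c i * d) → ∀ λs → value k a λs ≡ value k c λs ℤ.* + d
value-scale zero    d _    _  = refl
value-scale (suc k) {a} {c} d a≡cd λs =
  begin
    λs k ℤ.* + a k ℤ.+ value k a λs
  ≡⟨ cong₂ ℤ._+_ (cong (λs k ℤ.*_) (trans (cong +_ (a≡cd k ℕ.≤-refl)) (ℤ.pos-* (c k) d)))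
                 (value-scale k d (λ i i<k → a≡cd i (ℕ.m<n⇒m<1+n i<k)) λs) ⟩
    λs k ℤ.* (+ c k ℤ.* + d) ℤ.+ value k c λs ℤ.* + d
  ≡⟨ cong (ℤ._+ value k c λs ℤ.* + d) (sym (ℤ.*-assoc (λs k) (+ c k) (+ d))) ⟩
    λs k ℤ.* + c k ℤ.* + d ℤ.+ value k c λs ℤ.* + d
  ≡⟨ sym (ℤ.*-distribʳ-+ (+ d) (λs k ℤ.* + c k) (value k c λs)) ⟩
    value (suc k) c λs ℤ.* + d
  ∎
  where open ≡-Reasoning

HasSize-scale : ∀ h k {a c : ℕ → ℕ} d .{{_ : NonZero d}} → (∀ i → i < k → a i ≡ c i * d) →
                HasSize (InSignedSumset h k a) (length (signedSumset h k c))
HasSize-scale h k {a} {c} d a≡cd =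
  HasSize-map (ℤ._* + d) (ℤ.*-cancelʳ-≡ _ _ (+ d)) (λ z → mk⇔ (to z) (from z)) (HasSize-signedSumset h k c)
  where
  to : ∀ z → InSignedSumset h k a z → ∃ λ w → InSignedSumset h k c w × w ℤ.* + d ≡ z
  to z (λs , sign , weight≡h , refl) = value k c λs , (λs , sign , weight≡h , refl) , sym (value-scale k d a≡cd λs)
  from : ∀ z → (∃ λ w → InSignedSumset h k c w × w ℤ.* + d ≡ z) → InSignedSumset h k a z
  from z (_ , (λs , sign , weight≡h , refl) , refl) = λs , sign , weight≡h , value-scale k d a≡cd λs

without : (ℕ → ℕ) → ℕ → ℕ → List ℕ
without a p zero    = []
without a p (suc k) with k ≟ p
... | yes _ = without a p k
... | no  _ = a k ∷ without a p k

SubsetSum-without-suc : ∀ {a p k s} → SubsetSum (without a p k) s → SubsetSum (without a p (suc k)) s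
SubsetSum-without-suc {p = p} {k} σ with k ≟ p
... | yes _ = σ
... | no  _ = skip σ

SubsetSum-without-mono : ∀ {a p j k s} → j ≤′ k → SubsetSum (without a p j) s → SubsetSum (without a p k) s
SubsetSum-without-mono ≤′-refl       σ = σ
SubsetSum-without-mono {a} {p} (≤′-step {k} j≤k) σ = SubsetSum-without-suc {a} {p} {k} (SubsetSum-without-mono j≤k σ)

SubsetSum-without-single : ∀ {a p i} k → i < k → i ≢ p → SubsetSum (without a p k) (a i)
SubsetSum-without-single {a} {p} {i} (suc k) i<1+k i≢p with ℕ.m≤n⇒m<n∨m≡n (ℕ.≤-pred i<1+k)
... | inj₁ i<k  = SubsetSum-without-suc {a} {p} {k} (SubsetSum-without-single k i<k i≢p)
... | inj₂ refl with k ≟ p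
...   | yes k≡p = contradiction k≡p i≢p
...   | no  _   = SubsetSum-single

length-without-≤ : ∀ a {p} k → k ≤ p → length (without a p k) ≡ k
length-without-≤ a     zero    _     = refl
length-without-≤ a {p} (suc k) 1+k≤p with k ≟ p
... | yes refl = contradiction 1+k≤p (ℕ.n≮n k)
... | no  _    = cong suc (length-without-≤ a k (ℕ.<⇒≤ 1+k≤p))

length-without : ∀ a {p} k → p < k → suc (length (without a p k)) ≡ k
length-without a {p} (suc k) p<1+k with k ≟ p
... | yes refl = cong suc (length-without-≤ a k ℕ.≤-refl)
... | no  k≢p  = cong suc (length-without a k (ℕ.≤∧≢⇒< (ℕ.≤-pred p<1+k) (λ p≡k → k≢p (sym p≡k))))

sum-without-≤ : ∀ a {p} k → k ≤ p → sum (without a p k) ≡ sumℕ k a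
sum-without-≤ a     zero    _     = refl
sum-without-≤ a {p} (suc k) 1+k≤p with k ≟ p
... | yes refl = contradiction 1+k≤p (ℕ.n≮n k)
... | no  _    = cong (λ t → a k + t) (sum-without-≤ a k (ℕ.<⇒≤ 1+k≤p))

sum-without : ∀ a {p} k → p < k → a p + sum (without a p k) ≡ sumℕ k a
sum-without a {p} (suc k) p<1+k with k ≟ p
... | yes refl = cong (λ t → a k + t) (sum-without-≤ a k ℕ.≤-refl)
... | no  k≢p  = trans (x∙yz≈y∙xz (a p) (a k) _)
                   (cong (λ t → a k + t) (sum-without a k (ℕ.≤∧≢⇒< (ℕ.≤-pred p<1+k) (λ p≡k → k≢p (sym p≡k)))))

InSignedSumset-suc : ∀ {h k a z} t → IsSign t → InSignedSumset h k a z →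
                     InSignedSumset (ℤ.∣ t ∣ + h) (suc k) a (t ℤ.* + a k ℤ.+ z)
InSignedSumset-suc {k = k} {a} t t-sign (λs , sign , refl , refl) =
  update λs k t , sign′ ,
  cong₂ _+_ (cong ℤ.∣_∣ (update-≡ λs k t)) (weight-cong k (λ _ → update-< λs k t)) ,
  cong₂ ℤ._+_ (cong (ℤ._* + a k) (update-≡ λs k t)) (value-cong k a (λ _ → update-< λs k t))
  where
  sign′ : ∀ i → i < suc k → IsSign (update λs k t i)
  sign′ i i<1+k with ℕ.m≤n⇒m<n∨m≡n (ℕ.≤-pred i<1+k)
  ... | inj₁ i<k  = subst IsSign (sym (update-< λs k t i<k)) (sign i i<k)
  ... | inj₂ refl = subst IsSign (sym (update-≡ λs k t)) t-sign

coefficient+1-step : ∀ u t w → + 1 ℤ.* + u ℤ.+ (+ t ℤ.- + w) ≡ + (u + t) ℤ.- + w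
coefficient+1-step u t w = trans (ring (+ u) (+ t) (+ w)) (cong (ℤ._- + w) (sym (ℤ.pos-+ u t)))
  where
  ring : ∀ (u t w : ℤ) → + 1 ℤ.* u ℤ.+ (t ℤ.- w) ≡ (u ℤ.+ t) ℤ.- w
  ring = solve-∀

coefficient-1-step : ∀ u t s → -1ℤ ℤ.* + u ℤ.+ (+ t ℤ.- + (2 * s)) ≡ + (u + t) ℤ.- + (2 * (u + s))
coefficient-1-step u t s = begin
    -1ℤ ℤ.* + u ℤ.+ (+ t ℤ.- + (2 * s))             ≡⟨ ring (+ u) (+ t) (+ (2 * s)) ⟩
    (+ u ℤ.+ + t) ℤ.- (+ u ℤ.+ + u ℤ.+ + (2 * s))   ≡⟨ cong₂ ℤ._-_ (ℤ.pos-+ u t) u+u+2s ⟨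
    + (u + t) ℤ.- + (u + u + 2 * s)                 ≡⟨ cong (λ m → + (u + t) ℤ.- + m) (double u s) ⟩
    + (u + t) ℤ.- + (2 * (u + s))                   ∎
  where
  open ≡-Reasoning
  ring : ∀ (u t w : ℤ) → -1ℤ ℤ.* u ℤ.+ (t ℤ.- w) ≡ (u ℤ.+ t) ℤ.- (u ℤ.+ u ℤ.+ w)
  ring = solve-∀
  double : ∀ u s → u + u + 2 * s ≡ 2 * (u + s)
  double = ℕ.solve-∀
  u+u+2s : + (u + u + 2 * s) ≡ + u ℤ.+ + u ℤ.+ + (2 * s)
  u+u+2s = trans (ℤ.pos-+ (u + u) (2 * s)) (cong (ℤ._+ + (2 * s)) (ℤ.pos-+ u u))

SubsetSum⇒InSignedSumset : ∀ a p k {s} → SubsetSum (without a p k) s →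
  InSignedSumset (length (without a p k)) k a (+ sum (without a p k) ℤ.- + (2 * s))
SubsetSum⇒InSignedSumset a p zero    []       = (λ _ → + 0) , (λ _ ()) , refl , refl
SubsetSum⇒InSignedSumset a p (suc k) σ with k ≟ p
... | yes _ = subst (InSignedSumset _ (suc k) a) (ℤ.+-identityˡ _)
                (InSignedSumset-suc (+ 0) (inj₂ (inj₁ refl)) (SubsetSum⇒InSignedSumset a p k σ))
... | no  _ with σ
...   | skip {s = s} σ′ =
      subst (InSignedSumset (suc (length (without a p k))) (suc k) a) (coefficient+1-step (a k) (sum (without a p k)) (2 * s))
        (InSignedSumset-suc (+ 1) (inj₂ (inj₂ refl)) (SubsetSum⇒InSignedSumset a p k σ′))
...   | pick {s = s} σ′ =
      subst (InSignedSumset (suc (length (without a p k))) (suc k) a) (coefficient-1-step (a k) (sum (without a p k)) s)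
        (InSignedSumset-suc -1ℤ (inj₁ refl) (SubsetSum⇒InSignedSumset a p k σ′))

m-n≡m′-n′⇒m+n′≡m′+n : ∀ m n m′ n′ → + m ℤ.- + n ≡ + m′ ℤ.- + n′ → m + n′ ≡ m′ + n
m-n≡m′-n′⇒m+n′≡m′+n m n m′ n′ e = ℤ.+-injective (begin
    + (m + n′)                        ≡⟨ ℤ.pos-+ m n′ ⟩
    + m ℤ.+ + n′                      ≡⟨ shift (+ m) (+ n) (+ n′) ⟩
    (+ m ℤ.- + n) ℤ.+ (+ n ℤ.+ + n′)  ≡⟨ cong (ℤ._+ (+ n ℤ.+ + n′)) e ⟩
    (+ m′ ℤ.- + n′) ℤ.+ (+ n ℤ.+ + n′) ≡⟨ unshift (+ m′) (+ n′) (+ n) ⟩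
    + m′ ℤ.+ + n                      ≡⟨ ℤ.pos-+ m′ n ⟨
    + (m′ + n)                        ∎)
  where
  open ≡-Reasoning
  shift : ∀ (m n n′ : ℤ) → m ℤ.+ n′ ≡ (m ℤ.- n) ℤ.+ (n ℤ.+ n′)
  shift = solve-∀
  unshift : ∀ (m′ n′ n : ℤ) → (m′ ℤ.- n′) ℤ.+ (n ℤ.+ n′) ≡ m′ ℤ.+ n
  unshift = solve-∀

module _ (h : ℕ) (a : ℕ → ℕ) (a₀≡0 : a 0 ≡ 0) (a₁-odd : ¬ 2 ∣ a 1) (1≤h : 1 ≤ h) where

  signedSum : ℕ → ℕ → ℤ
  signedSum p s = + sum (without a p (suc h)) ℤ.- + (2 * s)

  signedSum-injective : ∀ p {s s′} → signedSum p s ≡ signedSum p s′ → s ≡ s′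
  signedSum-injective p {s} {s′} e =
    sym (ℕ.*-cancelˡ-≡ s′ s 2
      (ℕ.+-cancelˡ-≡ total (2 * s′) (2 * s) (m-n≡m′-n′⇒m+n′≡m′+n total (2 * s) total (2 * s′) e)))
    where total = sum (without a p (suc h))

  -- the two totals differ by the odd number a 1, so the two families have different parities
  signedSum-0≢1 : ∀ s s′ → signedSum 0 s ≢ signedSum 1 s′
  signedSum-0≢1 s s′ e = a₁-odd (∣m+n∣m⇒∣n (subst (2 ∣_) (sym 2s′+a₁≡2s) (m∣m*n s)) (m∣m*n s′))
    where
    T₀ = sum (without a 0 (suc h))
    T₁ = sum (without a 1 (suc h))
    totals : T₀ ≡ a 1 + T₁
    totals = trans (cong (_+ T₀) (sym a₀≡0))
               (trans (sum-without a (suc h) (s≤s z≤n)) (sym (sum-without a (suc h) (s≤s 1≤h))))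
    2s′+a₁≡2s : 2 * s′ + a 1 ≡ 2 * s
    2s′+a₁≡2s = ℕ.+-cancelˡ-≡ T₁ _ _ (begin
      T₁ + (2 * s′ + a 1)   ≡⟨ rearrange T₁ (2 * s′) (a 1) ⟩
      (a 1 + T₁) + 2 * s′   ≡⟨ cong (_+ 2 * s′) totals ⟨
      T₀ + 2 * s′           ≡⟨ m-n≡m′-n′⇒m+n′≡m′+n T₀ (2 * s) T₁ (2 * s′) e ⟩
      T₁ + 2 * s            ∎)
      where
      open ≡-Reasoning
      rearrange : ∀ t u v → t + (u + v) ≡ (v + t) + u
      rearrange = ℕ.solve-∀

  signedSum∈ : ∀ p → p ≤ h → ∀ {s} → SubsetSum (without a p (suc h)) s → InSignedSumset h (h + 1) a (signedSum p s)
  signedSum∈ p p≤h {s} σ =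
    subst₂ (λ m k → InSignedSumset m k a (signedSum p s))
      (ℕ.suc-injective (length-without a (suc h) (s≤s p≤h))) (ℕ.+-comm 1 h)
      (SubsetSum⇒InSignedSumset a p (suc h) σ)

  signedSumset-lower : ∀ {L₀ L₁} → DistinctSums (without a 0 (suc h)) L₀ → DistinctSums (without a 1 (suc h)) L₁ →
                       Σ ℕ λ n → HasSize (InSignedSumset h (h + 1) a) n × length L₀ + length L₁ ≤ n
  signedSumset-lower {L₀} {L₁} (u₀ , σ₀) (u₁ , σ₁) =
    _ , size , subst (_≤ _) lengths (HasSize-lower size unique members)
    where
    size = HasSize-signedSumset h (h + 1) a
    zs = map (signedSum 0) L₀ ++ map (signedSum 1) L₁
    unique = Unique.++⁺ (Unique.map⁺ (signedSum-injective 0) u₀) (Unique.map⁺ (signedSum-injective 1) u₁) disjoint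
      where
      disjoint : Disjoint (map (signedSum 0) L₀) (map (signedSum 1) L₁)
      disjoint (z∈₀ , z∈₁) with ∈-map⁻ (signedSum 0) z∈₀ | ∈-map⁻ (signedSum 1) z∈₁
      ... | s , _ , refl | s′ , _ , e = signedSum-0≢1 s s′ e
    members : All (InSignedSumset h (h + 1) a) zs
    members = All.++⁺ (All.map⁺ (All.map (signedSum∈ 0 z≤n) σ₀)) (All.map⁺ (All.map (signedSum∈ 1 1≤h) σ₁))
    lengths : length zs ≡ length L₀ + length L₁
    lengths = trans (length-++ (map (signedSum 0) L₀)) (cong₂ _+_ (length-map _ L₀) (length-map _ L₁))

increasing-multiples : ∀ (g : ℕ → ℕ) d N →
  (∀ i → 1 ≤ i → i < N → ∃ λ j → 1 ≤ j × j < N × g i ≡ j * d) →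
  (∀ i → 1 ≤ i → suc i < N → g i < g (suc i)) →
  ∀ i → 1 ≤ i → i < N → g i ≡ i * d
increasing-multiples g d N multiple increasing i 1≤i i<N =
  ℕ.≤-antisym (upper (N ∸ suc i) i 1≤i (ℕ.m+[n∸m]≡n i<N)) (lower i 1≤i i<N)
  where
  lower : ∀ i → 1 ≤ i → i < N → i * d ≤ g i
  lower (suc zero) _ 1<N with multiple 1 ℕ.≤-refl 1<N
  ... | j , 1≤j , _ , gi≡jd = subst (d + 0 ≤_) (sym gi≡jd) (ℕ.*-monoˡ-≤ d 1≤j)
  lower (suc (suc i)) _ 2+i<N with lower (suc i) (s≤s z≤n) (ℕ.<⇒≤ 2+i<N) | multiple (suc (suc i)) (s≤s z≤n) 2+i<N
  ... | [1+i]d≤g[1+i] | j , _ , _ , gi≡jd =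
    subst (suc (suc i) * d ≤_) (sym gi≡jd) (ℕ.*-monoˡ-≤ d (ℕ.*-cancelʳ-< d (suc i) j [1+i]d<jd))
    where
    [1+i]d<jd : suc i * d < j * d
    [1+i]d<jd = ℕ.≤-<-trans [1+i]d≤g[1+i] (subst (g (suc i) <_) gi≡jd (increasing (suc i) (s≤s z≤n) 2+i<N))
  upper : ∀ k i → 1 ≤ i → suc i + k ≡ N → g i ≤ i * d
  upper k i 1≤i refl with multiple i 1≤i (ℕ.m≤m+n (suc i) k)
  upper zero    i 1≤i refl | j , _ , j<1+i+0 , gi≡jd =
    subst (_≤ i * d) (sym gi≡jd) (ℕ.*-monoˡ-≤ d (ℕ.≤-pred (subst (j <_) (ℕ.+-identityʳ (suc i)) j<1+i+0)))
  upper (suc k) i 1≤i refl | j , _ , _ , gi≡jd =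
    subst (_≤ i * d) (sym gi≡jd) (ℕ.*-monoˡ-≤ d (ℕ.≤-pred (ℕ.*-cancelʳ-< d j (suc i) jd<[1+i]d)))
    where
    2+i≤N : suc (suc i) ≤ suc i + suc k
    2+i≤N = subst (suc (suc i) ≤_) (sym (ℕ.+-suc (suc i) k)) (ℕ.m≤m+n (suc (suc i)) k)
    jd<[1+i]d : j * d < suc i * d
    jd<[1+i]d = ℕ.<-≤-trans (subst (_< g (suc i)) gi≡jd (increasing i 1≤i 2+i≤N))
                  (upper k (suc i) (s≤s z≤n) (sym (ℕ.+-suc (suc i) k)))

doubles : ℕ → List ℕ
doubles zero          = []
doubles (suc zero)    = 1 ∷ []
doubles (suc (suc k)) = 2 * suc k ∷ doubles (suc k)

sum-doubles : ∀ k → sum (doubles (suc k)) ≡ suc (k * suc k)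
sum-doubles zero    = refl
sum-doubles (suc k) = trans (cong (_+_ (2 * suc k)) (sum-doubles k)) (step k)
  where
  step : ∀ k → 2 * suc k + suc (k * suc k) ≡ suc (suc k * suc (suc k))
  step = ℕ.solve-∀

doubles-complete : ∀ k → Complete (doubles k)
doubles-complete zero          = []
doubles-complete (suc zero)    = s≤s z≤n ∷ []
doubles-complete (suc (suc k)) =
  subst (2 * suc k ≤_) (cong suc (sym (sum-doubles k))) (bound k) ∷ doubles-complete (suc k)
  where
  bound : ∀ k → 2 * suc k ≤ suc (suc (k * suc k))
  bound zero    = ℕ.≤-refl
  bound (suc k) = subst (2 * suc (suc k) ≤_) (expand k) (ℕ.m≤m+n (2 * suc (suc k)) (k * suc k))
    where
    expand : ∀ k → 2 * suc (suc k) + k * suc k ≡ suc (suc (suc k * suc (suc k)))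
    expand = ℕ.solve-∀

downFrom-complete : ∀ k → Complete (downFrom k)
downFrom-complete zero    = []
downFrom-complete (suc k) = bound k ∷ downFrom-complete k
  where
  bound : ∀ k → k ≤ suc (sum (downFrom k))
  bound zero    = z≤n
  bound (suc k) = s≤s (ℕ.m≤m+n k (sum (downFrom k)))

sum-downFrom : ∀ k → 2 * sum (downFrom (suc k)) ≡ suc k * k
sum-downFrom zero    = refl
sum-downFrom (suc k) =
  trans (ℕ.*-distribˡ-+ 2 (suc k) (sum (downFrom (suc k)))) (trans (cong (_+_ (2 * suc k)) (sum-downFrom k)) (step k))
  where
  step : ∀ k → 2 * suc k + suc k * k ≡ suc (suc k) * suc k
  step = ℕ.solve-∀

count-identity : ∀ h → 1 ≤ h → 3 * (h * (h ∸ 1)) + 6 ≡ 2 * (suc (sum (doubles h)) + suc (sum (downFrom h)))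
count-identity (suc k) _ = begin
    3 * (suc k * k) + 6                         ≡⟨ regroup k ⟩
    2 * suc (suc (k * suc k)) + 2 + suc k * k   ≡⟨ cong₂ (λ d t → 2 * suc d + 2 + t) (sum-doubles k) (sum-downFrom k) ⟨
    2 * suc D + 2 + 2 * S                       ≡⟨ factor (suc D) S ⟩
    2 * (suc D + suc S)                         ∎
  where
  open ≡-Reasoning
  D = sum (doubles (suc k))
  S = sum (downFrom (suc k))
  regroup : ∀ k → 3 * (suc k * k) + 6 ≡ 2 * suc (suc (k * suc k)) + 2 + suc k * k
  regroup = ℕ.solve-∀
  factor : ∀ d s → 2 * d + 2 + 2 * s ≡ 2 * (d + suc s)
  factor = ℕ.solve-∀

coeff : List ℕ → ℕ → ℕ
coeff []       _       = 0
coeff (c ∷ cs) zero    = c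
coeff (c ∷ cs) (suc i) = coeff cs i

target : ℕ → ℕ
target j = j * j + j + 2

module Proof
  (h : ℕ) (a : ℕ → ℕ) (a₀≡0 : a 0 ≡ 0) (a-increasing : ∀ i j → i < j → j ≤ h → a i < a j)
  (a₁-odd : ¬ 2 ∣ a 1) (a₂≡2a₁ : a 2 ≡ 2 * a 1) (a₃≡4a₁ : a 3 ≡ 4 * a 1) (4≤h : 4 ≤ h) where

  x : ℕ
  x = a 1

  1≤h : 1 ≤ h
  1≤h = ℕ.≤-trans (s≤s z≤n) 4≤h

  x>0 : x > 0
  x>0 = subst (_< x) a₀≡0 (a-increasing 0 1 (s≤s z≤n) 1≤h)

  instance
    x-nonZero : NonZero x
    x-nonZero = ℕ.>-nonZero x>0

  Sums≥ : ℕ → ℕ → Set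
  Sums≥ j n = Σ ℕ λ n₀ → Σ ℕ λ n₁ →
    SubsetSums≥ (without a 0 (suc j)) n₀ × SubsetSums≥ (without a 1 (suc j)) n₁ × n ≤ n₀ + n₁

  Sums≥⇒size : ∀ {n} → Sums≥ h n → Σ ℕ λ m → HasSize (InSignedSumset h (h + 1) a) m × n ≤ m
  Sums≥⇒size (n₀ , n₁ , (L₀ , d₀ , n₀≤) , (L₁ , d₁ , n₁≤) , n≤) with signedSumset-lower h a a₀≡0 a₁-odd 1≤h d₀ d₁
  ... | m , size , L≤m = m , size , ℕ.≤-trans n≤ (ℕ.≤-trans (ℕ.+-mono-≤ n₀≤ n₁≤) L≤m)

  from₃ : ℕ → List ℕ → List ℕ
  from₃ zero    rest = a 3 ∷ rest
  from₃ (suc k) rest = a (4 + k) ∷ from₃ k rest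

  length-from₃ : ∀ k rest → length (from₃ k rest) ≡ suc k + length rest
  length-from₃ zero    rest = refl
  length-from₃ (suc k) rest = cong suc (length-from₃ k rest)

  from₃-descending : ∀ k {rest} → 4 + k ≤ h → Linked _>_ (a 3 ∷ rest) → Linked _>_ (a (4 + k) ∷ from₃ k rest)
  from₃-descending zero    4≤h  desc = a-increasing 3 4 ℕ.≤-refl 4≤h ∷ desc
  from₃-descending (suc k) 5+k≤h desc =
    a-increasing (4 + k) (5 + k) ℕ.≤-refl 5+k≤h ∷ from₃-descending k (ℕ.<⇒≤ 5+k≤h) desc

  from₃-sums : ∀ {p K} k {rest} → p < 3 → 3 + k < K → All (SubsetSum (without a p K)) rest →
               All (SubsetSum (without a p K)) (from₃ k rest)
  from₃-sums zero    p<3 3<K   σs = SubsetSum-without-single _ 3<K (λ 3≡p → ℕ.<⇒≱ p<3 (ℕ.≤-reflexive 3≡p)) ∷ σs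
  from₃-sums (suc k) p<3 4+k<K σs =
    SubsetSum-without-single _ 4+k<K (λ e → ℕ.<⇒≱ p<3 (subst (3 ≤_) e (ℕ.m≤m+n 3 (suc k)))) ∷
    from₃-sums k p<3 (ℕ.<⇒≤ 4+k<K) σs

  rest₀ : List ℕ
  rest₀ = a 2 + a 1 ∷ a 2 ∷ a 1 ∷ 0 ∷ []

  rest₁ : List ℕ
  rest₁ = a 2 ∷ 0 ∷ []

  a₁<a₂ : a 1 < a 2
  a₁<a₂ = a-increasing 1 2 (s≤s (s≤s z≤n)) (ℕ.≤-trans (s≤s (s≤s z≤n)) 4≤h)

  a₂+a₁<a₃ : a 2 + a 1 < a 3
  a₂+a₁<a₃ = subst₂ _<_ (cong (_+ x) (sym a₂≡2a₁)) (trans (four x) (sym a₃≡4a₁)) (ℕ.m<m+n (2 * x + x) x>0)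
    where
    four : ∀ x → 2 * x + x + x ≡ 4 * x
    four = ℕ.solve-∀

  rest₀-descending : Linked _>_ (a 3 ∷ rest₀)
  rest₀-descending = a₂+a₁<a₃ ∷ ℕ.m<m+n (a 2) x>0 ∷ a₁<a₂ ∷ x>0 ∷ [-]

  rest₁-descending : Linked _>_ (a 3 ∷ rest₁)
  rest₁-descending = ℕ.<-trans (ℕ.m<m+n (a 2) x>0) a₂+a₁<a₃ ∷ ℕ.<-trans x>0 a₁<a₂ ∷ [-]

  rest₀-sums : ∀ K → 3 ≤′ K → All (SubsetSum (without a 0 K)) rest₀
  rest₀-sums K 3≤K =
    SubsetSum-without-mono 3≤K (pick SubsetSum-single) ∷
    SubsetSum-without-single K (ℕ.≤′⇒≤ 3≤K) (λ ()) ∷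
    SubsetSum-without-single K (ℕ.<-trans (s≤s (s≤s z≤n)) (ℕ.≤′⇒≤ 3≤K)) (λ ()) ∷
    SubsetSum-0 _ ∷ []

  rest₁-sums : ∀ K → 3 ≤′ K → All (SubsetSum (without a 1 K)) rest₁
  rest₁-sums K 3≤K = SubsetSum-without-single K (ℕ.≤′⇒≤ 3≤K) (λ ()) ∷ SubsetSum-0 _ ∷ []

  grow-from₃ : ∀ p k {rest n} → p < 3 → 4 + k ≤ h → Linked _>_ (a 3 ∷ rest) →
               All (SubsetSum (without a p (4 + k))) rest → SubsetSums≥ (without a p (4 + k)) n →
               SubsetSums≥ (a (4 + k) ∷ without a p (4 + k)) (n + (suc k + length rest))
  grow-from₃ p k {rest} {n} p<3 4+k≤h rest-desc rest-sums S =
    subst (SubsetSums≥ _) (cong (_+_ n) (length-from₃ k rest))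
      (grow≥ S (descending⇒unique (Linked.tail desc) , from₃-sums k p<3 ℕ.≤-refl rest-sums) (descending-below desc))
    where
    desc : Linked _>_ (a (4 + k) ∷ from₃ k rest)
    desc = from₃-descending k 4+k≤h rest-desc

  step : ∀ {j} → 3 ≤ j → suc j ≤ h → Sums≥ j (target j) → Sums≥ (suc j) (target (suc j))
  step {suc (suc (suc k))} (s≤s (s≤s (s≤s z≤n))) 4+k≤h (n₀ , n₁ , S₀ , S₁ , target≤) =
    _ , _ ,
    grow-from₃ 0 k (s≤s z≤n) 4+k≤h rest₀-descending (rest₀-sums (4 + k) (ℕ.≤⇒≤′ (ℕ.m≤m+n 3 (suc k)))) S₀ ,
    grow-from₃ 1 k (s≤s (s≤s z≤n)) 4+k≤h rest₁-descending (rest₁-sums (4 + k) (ℕ.≤⇒≤′ (ℕ.m≤m+n 3 (suc k)))) S₁ ,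
    subst₂ _≤_ (sym (target-step k)) (regroup n₀ n₁ (suc k + 4) (suc k + 2))
      (ℕ.+-monoˡ-≤ (suc k + 4 + (suc k + 2)) target≤)
    where
    target-step : ∀ k → (4 + k) * (4 + k) + (4 + k) + 2
                        ≡ (3 + k) * (3 + k) + (3 + k) + 2 + (suc k + 4 + (suc k + 2))
    target-step = ℕ.solve-∀
    regroup : ∀ n₀ n₁ b₀ b₁ → n₀ + n₁ + (b₀ + b₁) ≡ n₀ + b₀ + (n₁ + b₁)
    regroup = ℕ.solve-∀

  iterate : ∀ {i j} → 3 ≤ i → i ≤′ j → j ≤ h → Sums≥ i (target i) → Sums≥ j (target j)
  iterate 3≤i ≤′-refl           _     bound = bound
  iterate 3≤i (≤′-step i≤j) 1+j≤h bound =
    step (ℕ.≤-trans 3≤i (ℕ.≤′⇒≤ i≤j)) 1+j≤h (iterate 3≤i i≤j (ℕ.<⇒≤ 1+j≤h) bound)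

  iterate-to-h : ∀ {i} → 3 ≤ i → i ≤ h → Sums≥ i (target i) → Sums≥ h (target h)
  iterate-to-h 3≤i i≤h = iterate 3≤i (ℕ.≤⇒≤′ i≤h) ℕ.≤-refl

  Sums≥-weaken : ∀ {j m n} → m ≤ n → Sums≥ j n → Sums≥ j m
  Sums≥-weaken m≤n (n₀ , n₁ , S₀ , S₁ , n≤) = n₀ , n₁ , S₀ , S₁ , ℕ.≤-trans m≤n n≤

  without₀-4 : without a 0 4 ≡ map (_* x) (4 ∷ 2 ∷ 1 ∷ [])
  without₀-4 = cong₂ _∷_ a₃≡4a₁ (cong₂ _∷_ a₂≡2a₁ (cong (_∷ []) (sym (ℕ.*-identityˡ x))))

  without₁-4 : without a 1 4 ≡ map (_* x) (4 ∷ 2 ∷ 0 ∷ [])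
  without₁-4 = cong₂ _∷_ a₃≡4a₁ (cong₂ _∷_ a₂≡2a₁ (cong (_∷ []) a₀≡0))

  without₀-5 : ∀ q → a 4 ≡ q * x → without a 0 5 ≡ map (_* x) (q ∷ 4 ∷ 2 ∷ 1 ∷ [])
  without₀-5 q e = cong₂ _∷_ e without₀-4

  without₁-5 : ∀ q → a 4 ≡ q * x → without a 1 5 ≡ map (_* x) (q ∷ 4 ∷ 2 ∷ 0 ∷ [])
  without₁-5 q e = cong₂ _∷_ e without₁-4

  multiples-sums : ∀ {xs} cs → xs ≡ map (_* x) cs → DistinctSums xs (map (_* x) (sumsOf cs))
  multiples-sums cs refl = DistinctSums-scale x (DistinctSums-sumsOf cs)

  multiples-sums≥ : ∀ {xs} cs → xs ≡ map (_* x) cs → SubsetSums≥ xs (length (sumsOf cs))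
  multiples-sums≥ cs xs≡ = _ , multiples-sums cs xs≡ , ℕ.≤-reflexive (sym (length-map (_* x) (sumsOf cs)))

  grow-multiples : ∀ {y xs n} cs m → xs ≡ map (_* x) cs → m * x < y → SubsetSums≥ xs n →
                   SubsetSums≥ (y ∷ xs) (n + length (filter (_≤? m) (sumsOf cs)))
  grow-multiples {y} {n = n} cs m refl m*x<y S =
    subst (SubsetSums≥ (y ∷ map (_* x) cs)) (cong (_+_ n) (length-map (_* x) small))
      (grow≥ S (DistinctSums-scale x (DistinctSums-filter (_≤? m) (DistinctSums-sumsOf cs)))
               (All.map⁺ (All.map (λ k≤m → ℕ.≤-<-trans (ℕ.*-monoˡ-≤ x k≤m) m*x<y)
                                   (All.all-filter (_≤? m) (sumsOf cs)))))
    where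
    small = filter (_≤? m) (sumsOf cs)

  double-multiples : ∀ {y xs} cs → xs ≡ map (_* x) cs → (∀ m → m ≤ sum cs → y ≢ m * x) →
                     SubsetSums≥ (y ∷ xs) (length (sumsOf cs) + length (sumsOf cs))
  double-multiples {y} cs refl y≢ = _ , extend D D fresh , ℕ.≤-reflexive (sym lengths)
    where
    X = map (_* x) (sumsOf cs)
    D = multiples-sums cs refl
    fresh : ∀ {b c} → b ∈ X → c ∈ X → y + c ≢ b
    fresh b∈ c∈ e with ∈-map⁻ (_* x) b∈ | ∈-map⁻ (_* x) c∈
    ... | k , k∈ , refl | k′ , _ , refl =
      y≢ (k ∸ k′) (ℕ.≤-trans (ℕ.m∸n≤m k k′) (SubsetSum⇒≤sum (All.lookup (proj₂ (DistinctSums-sumsOf cs)) k∈)))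
         (trans (sym (ℕ.m+n∸n≡m y (k′ * x))) (trans (cong (_∸ k′ * x) e) (sym (ℕ.*-distribʳ-∸ x k k′))))
    lengths : length (X ++ map (_+_ y) X) ≡ length (sumsOf cs) + length (sumsOf cs)
    lengths = trans (length-++ X)
      (cong₂ _+_ (length-map (_* x) (sumsOf cs)) (trans (length-map (_+_ y) X) (length-map (_* x) (sumsOf cs))))

  4x<a₄ : 4 * x < a 4
  4x<a₄ = subst (_< a 4) a₃≡4a₁ (a-increasing 3 4 ℕ.≤-refl 4≤h)

  a₄-cases : (a 4 ≡ 5 * x) ⊎ (a 4 ≡ 6 * x) ⊎ (a 4 ≡ 7 * x) ⊎ (∀ m → m ≤ 7 → a 4 ≢ m * x)
  a₄-cases with a 4 ≟ 5 * x | a 4 ≟ 6 * x | a 4 ≟ 7 * x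
  ... | yes e | _     | _     = inj₁ e
  ... | no _  | yes e | _     = inj₂ (inj₁ e)
  ... | no _  | no _  | yes e = inj₂ (inj₂ (inj₁ e))
  ... | no ≢5 | no ≢6 | no ≢7 = inj₂ (inj₂ (inj₂ not-multiple))
    where
    not-multiple : ∀ m → m ≤ 7 → a 4 ≢ m * x
    not-multiple m m≤7 e with m ≟ 5 | m ≟ 6 | m ≟ 7
    ... | yes refl | _        | _        = ≢5 e
    ... | no _     | yes refl | _        = ≢6 e
    ... | no _     | no _     | yes refl = ≢7 e
    ... | no m≢5   | no m≢6   | no m≢7   = ℕ.<⇒≱ 4x<a₄ (subst (_≤ 4 * x) (sym e) (ℕ.*-monoˡ-≤ x m≤4))
      where
      m≤4 : m ≤ 4
      m≤4 = ℕ.≤-pred (ℕ.≤∧≢⇒< (ℕ.≤-pred (ℕ.≤∧≢⇒< (ℕ.≤-pred (ℕ.≤∧≢⇒< m≤7 m≢7)) m≢6)) m≢5)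

  between-multiples : ∀ q {y} → q * x < y → y < suc q * x → ∀ m → y ≢ m * x
  between-multiples q q*x<y y<[1+q]*x m refl with m ≤? q
  ... | yes m≤q = ℕ.<⇒≱ q*x<y (ℕ.*-monoˡ-≤ x m≤q)
  ... | no  m≰q = ℕ.<⇒≱ y<[1+q]*x (ℕ.*-monoˡ-≤ x (ℕ.≰⇒> m≰q))

  -- the numbers of subset sums of the concrete coefficient lists below are computed by normalisation
  level₄-not-multiple : (∀ m → m ≤ 7 → a 4 ≢ m * x) → Sums≥ 4 24
  level₄-not-multiple a₄≢ =
    _ , _ ,
    double-multiples (4 ∷ 2 ∷ 1 ∷ []) without₀-4 a₄≢ ,
    double-multiples (4 ∷ 2 ∷ 0 ∷ []) without₁-4 (λ m m≤6 → a₄≢ m (ℕ.m≤n⇒m≤1+n m≤6)) ,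
    ℕ.≤-refl

  level₄-a₄≡7x : a 4 ≡ 7 * x → Sums≥ 4 23
  level₄-a₄≡7x e =
    _ , _ ,
    multiples-sums≥ (7 ∷ 4 ∷ 2 ∷ 1 ∷ []) (without₀-5 7 e) ,
    multiples-sums≥ (7 ∷ 4 ∷ 2 ∷ 0 ∷ []) (without₁-5 7 e) ,
    ℕ.≤-refl

  A₀ : ℕ → Set
  A₀ = λ x → (x ≡ 0) ⊎ (x ≡ a 1) ⊎ (x ≡ 2 * a 1) ⊎ (x ≡ 4 * a 1) ⊎ (x ≡ 6 * a 1)

  prefix-multiples : ∀ q → a 4 ≡ q * x → ∀ i → i < 5 → a i ≡ coeff (0 ∷ 1 ∷ 2 ∷ 4 ∷ q ∷ []) i * x
  prefix-multiples q e 0 _ = a₀≡0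
  prefix-multiples q e 1 _ = sym (ℕ.*-identityˡ x)
  prefix-multiples q e 2 _ = a₂≡2a₁
  prefix-multiples q e 3 _ = a₃≡4a₁
  prefix-multiples q e 4 _ = e
  prefix-multiples q e (suc (suc (suc (suc (suc _))))) (s≤s (s≤s (s≤s (s≤s (s≤s ())))))

  size-at-4 : ∀ q → a 4 ≡ q * x →
              HasSize (InSignedSumset 4 5 a) (length (signedSumset 4 5 (coeff (0 ∷ 1 ∷ 2 ∷ 4 ∷ q ∷ []))))
  size-at-4 q e = HasSize-scale 4 5 {c = coeff (0 ∷ 1 ∷ 2 ∷ 4 ∷ q ∷ [])} x (prefix-multiples q e)

  a₄≡6x⇒A₀ : a 4 ≡ 6 * x → SetEq 5 a A₀
  a₄≡6x⇒A₀ e y = mk⇔ to from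
    where
    to : (∃ λ i → i < 5 × a i ≡ y) → A₀ y
    to (0 , _ , refl) = inj₁ a₀≡0
    to (1 , _ , refl) = inj₂ (inj₁ refl)
    to (2 , _ , refl) = inj₂ (inj₂ (inj₁ a₂≡2a₁))
    to (3 , _ , refl) = inj₂ (inj₂ (inj₂ (inj₁ a₃≡4a₁)))
    to (4 , _ , refl) = inj₂ (inj₂ (inj₂ (inj₂ e)))
    to (suc (suc (suc (suc (suc _)))) , s≤s (s≤s (s≤s (s≤s (s≤s ())))) , _)
    from : A₀ y → ∃ λ i → i < 5 × a i ≡ y
    from (inj₁ refl)                         = 0 , s≤s z≤n , a₀≡0
    from (inj₂ (inj₁ refl))                  = 1 , s≤s (s≤s z≤n) , refl
    from (inj₂ (inj₂ (inj₁ refl)))           = 2 , s≤s (s≤s (s≤s z≤n)) , a₂≡2a₁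
    from (inj₂ (inj₂ (inj₂ (inj₁ refl))))    = 3 , s≤s (s≤s (s≤s (s≤s z≤n))) , a₃≡4a₁
    from (inj₂ (inj₂ (inj₂ (inj₂ refl))))    = 4 , ℕ.≤-refl , e

  A₀⇒a₄≡6x : SetEq 5 a A₀ → a 4 ≡ 6 * x
  A₀⇒a₄≡6x se with Equivalence.to (se (a 4)) (4 , ℕ.≤-refl , refl)
  ... | inj₁ e                       = contradiction e (ℕ.>⇒≢ (ℕ.≤-<-trans z≤n 4x<a₄))
  ... | inj₂ (inj₁ e)                = contradiction e (ℕ.>⇒≢ (a-increasing 1 4 (s≤s (s≤s z≤n)) 4≤h))
  ... | inj₂ (inj₂ (inj₁ e))         = contradiction (trans e (sym a₂≡2a₁)) (ℕ.>⇒≢ (a-increasing 2 4 (s≤s (s≤s (s≤s z≤n))) 4≤h))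
  ... | inj₂ (inj₂ (inj₂ (inj₁ e)))  = contradiction e (ℕ.>⇒≢ 4x<a₄)
  ... | inj₂ (inj₂ (inj₂ (inj₂ e)))  = e

  module _ (h≡4 : h ≡ 4) where

    at-4 : ∀ {n} → HasSize (InSignedSumset 4 5 a) n → HasSize (InSignedSumset h (h + 1) a) n
    at-4 {n} = subst (λ j → HasSize (InSignedSumset j (j + 1) a) n) (sym h≡4)

    part₁ : SetEq (h + 1) a A₀ → HasSize (InSignedSumset h (h + 1) a) 21
    part₁ se = at-4 (size-at-4 6 (A₀⇒a₄≡6x (subst (λ j → SetEq (j + 1) a A₀) h≡4 se)))

    part₂ : ¬ SetEq (h + 1) a A₀ → Σ ℕ λ n → HasSize (InSignedSumset h (h + 1) a) n × 23 ≤ n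
    part₂ ¬se with a₄-cases
    ... | inj₁ e                 = _ , at-4 (size-at-4 5 e) , ℕ.≤-refl
    ... | inj₂ (inj₁ e)          = contradiction (subst (λ j → SetEq (j + 1) a A₀) (sym h≡4) (a₄≡6x⇒A₀ e)) ¬se
    ... | inj₂ (inj₂ (inj₁ e))   = Sums≥⇒size (subst (λ j → Sums≥ j 23) (sym h≡4) (level₄-a₄≡7x e))
    ... | inj₂ (inj₂ (inj₂ a₄≢)) =
      Sums≥⇒size (subst (λ j → Sums≥ j 23) (sym h≡4) (Sums≥-weaken {4} (ℕ.n≤1+n 23) (level₄-not-multiple a₄≢)))

  A₁ : ℕ → Set
  A₁ = λ x → (x ≡ 0) ⊎ (x ≡ a 1) ⊎ (∃ λ j → 1 ≤ j × j ≤ h ∸ 1 × x ≡ a 1 * (2 * j))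

  module _ (se : SetEq (h + 1) a A₁) where

    a-even : ∀ i → 1 ≤ i → i < h → ∃ λ j → 1 ≤ j × j < h × a (suc i) ≡ j * (2 * x)
    a-even i 1≤i i<h with Equivalence.to (se (a (suc i))) (suc i , subst (suc i <_) (ℕ.+-comm 1 h) (s≤s i<h) , refl)
    ... | inj₁ e                         = contradiction (trans e (sym a₀≡0)) (ℕ.>⇒≢ (a-increasing 0 (suc i) (s≤s z≤n) i<h))
    ... | inj₂ (inj₁ e)                  = contradiction e (ℕ.>⇒≢ (a-increasing 1 (suc i) (s≤s 1≤i) i<h))
    ... | inj₂ (inj₂ (j , 1≤j , j≤h-1 , e)) =
      j , 1≤j , ℕ.m≤pred[n]⇒suc[m]≤n {{ℕ.>-nonZero 1≤h}} j≤h-1 , trans e (swap x j)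
      where
      swap : ∀ x j → x * (2 * j) ≡ j * (2 * x)
      swap = ℕ.solve-∀

    a-exact : ∀ i → 1 ≤ i → i < h → a (suc i) ≡ i * (2 * x)
    a-exact = increasing-multiples (λ i → a (suc i)) (2 * x) h a-even
                (λ i _ 1+i<h → a-increasing (suc i) (suc (suc i)) ℕ.≤-refl 1+i<h)

    without₀-doubles : ∀ k → k ≤ h → without a 0 (suc k) ≡ map (_* x) (doubles k)
    without₀-doubles zero          _     = refl
    without₀-doubles (suc zero)    _     = cong (_∷ []) (sym (ℕ.*-identityˡ x))
    without₀-doubles (suc (suc k)) 2+k≤h =
      cong₂ _∷_ (trans (a-exact (suc k) (s≤s z≤n) 2+k≤h) (swap (suc k) x)) (without₀-doubles (suc k) (ℕ.<⇒≤ 2+k≤h))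
      where
      swap : ∀ k x → k * (2 * x) ≡ 2 * k * x
      swap = ℕ.solve-∀

    without₁-downFrom : ∀ k → 1 ≤ k → k ≤ h → without a 1 (suc k) ≡ map (_* (2 * x)) (downFrom k)
    without₁-downFrom (suc zero)    _ _     = cong (_∷ []) a₀≡0
    without₁-downFrom (suc (suc k)) _ 2+k≤h =
      cong₂ _∷_ (a-exact (suc k) (s≤s z≤n) 2+k≤h) (without₁-downFrom (suc k) (s≤s z≤n) (ℕ.<⇒≤ 2+k≤h))

    instance
      2x-nonZero : NonZero (2 * x)
      2x-nonZero = ℕ.m*n≢0 2 x

    sums-complete : Sums≥ h (suc (sum (doubles h)) + suc (sum (downFrom h)))
    sums-complete =
      _ , _ ,
      subst (λ xs → SubsetSums≥ xs _) (sym (without₀-doubles h ℕ.≤-refl))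
        (Complete⇒SubsetSums≥ x (doubles-complete h)) ,
      subst (λ xs → SubsetSums≥ xs _) (sym (without₁-downFrom h 1≤h ℕ.≤-refl))
        (Complete⇒SubsetSums≥ (2 * x) (downFrom-complete h)) ,
      ℕ.≤-refl

    part₃ : Σ ℕ λ n → HasSize (InSignedSumset h (h + 1) a) n × 3 * (h * (h ∸ 1)) + 6 ≤ 2 * n
    part₃ with Sums≥⇒size sums-complete
    ... | n , size , count≤n = n , size , subst (_≤ 2 * n) (sym (count-identity h 1≤h)) (ℕ.*-monoʳ-≤ 2 count≤n)

  module _ (5≤h : 5 ≤ h) where

    a₄<a₅ : a 4 < a 5
    a₄<a₅ = a-increasing 4 5 ℕ.≤-refl 5≤h

    grow₁-to-5 : ∀ {n} → SubsetSums≥ (without a 1 5) n → SubsetSums≥ (without a 1 6) (n + 4)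
    grow₁-to-5 = grow-from₃ 1 1 (s≤s (s≤s z≤n)) 5≤h rest₁-descending (rest₁-sums 5 (ℕ.≤⇒≤′ (s≤s (s≤s (s≤s z≤n)))))

    level₅-a₄≡6x : a 4 ≡ 6 * x → Sums≥ 5 32
    level₅-a₄≡6x e =
      _ , _ ,
      grow-multiples (6 ∷ 4 ∷ 2 ∷ 1 ∷ []) 6 (without₀-5 6 e) (subst (_< a 5) e a₄<a₅)
        (multiples-sums≥ (6 ∷ 4 ∷ 2 ∷ 1 ∷ []) (without₀-5 6 e)) ,
      grow₁-to-5 (multiples-sums≥ (6 ∷ 4 ∷ 2 ∷ 0 ∷ []) (without₁-5 6 e)) ,
      ℕ.≤-refl

    level₅-a₄≡5x : a 4 ≡ 5 * x → Sums≥ 5 32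
    level₅-a₄≡5x e with ℕ.<-cmp (a 5) (6 * x)
    ... | tri< a₅<6x _ _ =
      _ , _ ,
      double-multiples (5 ∷ 4 ∷ 2 ∷ 1 ∷ []) (without₀-5 5 e)
        (λ m _ → between-multiples 5 (subst (_< a 5) e a₄<a₅) a₅<6x m) ,
      grow₁-to-5 (multiples-sums≥ (5 ∷ 4 ∷ 2 ∷ 0 ∷ []) (without₁-5 5 e)) ,
      ℕ.≤ᵇ⇒≤ 32 38 _
    ... | tri≈ _ a₅≡6x _ =
      _ , _ ,
      multiples-sums≥ (6 ∷ 5 ∷ 4 ∷ 2 ∷ 1 ∷ []) (cong₂ _∷_ a₅≡6x (without₀-5 5 e)) ,
      multiples-sums≥ (6 ∷ 5 ∷ 4 ∷ 2 ∷ 0 ∷ []) (cong₂ _∷_ a₅≡6x (without₁-5 5 e)) ,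
      ℕ.n≤1+n 32
    ... | tri> _ _ 6x<a₅ =
      _ , _ ,
      grow-multiples (5 ∷ 4 ∷ 2 ∷ 1 ∷ []) 6 (without₀-5 5 e) 6x<a₅
        (multiples-sums≥ (5 ∷ 4 ∷ 2 ∷ 1 ∷ []) (without₀-5 5 e)) ,
      grow₁-to-5 (multiples-sums≥ (5 ∷ 4 ∷ 2 ∷ 0 ∷ []) (without₁-5 5 e)) ,
      ℕ.≤-refl

    sums-at-h : Sums≥ h (target h)
    sums-at-h with a₄-cases
    ... | inj₁ e                 = iterate-to-h (ℕ.≤ᵇ⇒≤ 3 5 _) 5≤h (level₅-a₄≡5x e)
    ... | inj₂ (inj₁ e)          = iterate-to-h (ℕ.≤ᵇ⇒≤ 3 5 _) 5≤h (level₅-a₄≡6x e)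
    ... | inj₂ (inj₂ (inj₁ e))   =
      iterate-to-h (ℕ.≤ᵇ⇒≤ 3 4 _) 4≤h (Sums≥-weaken {4} (ℕ.n≤1+n 22) (level₄-a₄≡7x e))
    ... | inj₂ (inj₂ (inj₂ a₄≢)) =
      iterate-to-h (ℕ.≤ᵇ⇒≤ 3 4 _) 4≤h (Sums≥-weaken {4} (ℕ.≤ᵇ⇒≤ 22 24 _) (level₄-not-multiple a₄≢))

    part₄ : Σ ℕ λ n → HasSize (InSignedSumset h (h + 1) a) n × h * h + h + 2 ≤ n
    part₄ = Sums≥⇒size sums-at-h

lemma2p11 : (h : ℕ) → 4 ≤ h → (a : ℕ → ℕ) →
    a 0 ≡ 0 →
    (∀ i j → i < j → j ≤ h → a i < a j) →
    ¬ (2 ∣ a 1) →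
    a 2 ≡ 2 * a 1 →
    a 3 ≡ 4 * a 1 →
    let S : ℤ → Set
        S = InSignedSumset h (h + 1) a
        A₀ : ℕ → Set
        A₀ = λ x → (x ≡ 0) ⊎ (x ≡ a 1) ⊎ (x ≡ 2 * a 1) ⊎ (x ≡ 4 * a 1) ⊎ (x ≡ 6 * a 1)
        A₁ : ℕ → Set
        A₁ = λ x → (x ≡ 0) ⊎ (x ≡ a 1) ⊎ (∃ λ j → 1 ≤ j × j ≤ h ∸ 1 × x ≡ a 1 * (2 * j))
    in
    (h ≡ 4 → SetEq (h + 1) a A₀ → HasSize S 21) ×
    (h ≡ 4 → ¬ SetEq (h + 1) a A₀ → Σ ℕ λ n → HasSize S n × 23 ≤ n) ×
    (5 ≤ h → SetEq (h + 1) a A₁ →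
       Σ ℕ λ n → HasSize S n × 3 * (h * (h ∸ 1)) + 6 ≤ 2 * n) ×
    (5 ≤ h → ¬ SetEq (h + 1) a A₁ → Σ ℕ λ n → HasSize S n × h * h + h + 2 ≤ n)
lemma2p11 h 4≤h a a₀≡0 a-increasing a₁-odd a₂≡2a₁ a₃≡4a₁ =
  part₁ , part₂ , (λ _ → part₃) , (λ 5≤h _ → part₄ 5≤h)
  where open Proof h a a₀≡0 a-increasing a₁-odd a₂≡2a₁ a₃≡4a₁ 4≤h
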